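{- Every Eulerian digraph $G$ with $n$ vertices and $m \ge 1$ arcs has a directed cycle of length at least $1 + \lfloor \sqrt{m/n} \rfloor$. Moreover, $G$ has a directed cycle of length at least $1 + \max\{ m^2/(24n^3), \lfloor \sqrt{m/n} \rfloor \}$.
   Context: All digraphs are finite and simple: no loops and no multiple arcs, but two arcs in opposite directions between the same pair of vertices are allowed (so a directed cycle may have length $2$). A digraph is Eulerian if every vertex has in-degree equal to its out-degree. -}

module Defs where

open import Data.Nat using (ℕ; zero; suc; _+_; _*_; _≤_; _≤?_; _/_)
open import Data.Bool using (Bool; true; false; if_then_else_)
open import Data.Fin using (Fin; zero; suc; inject₁; fromℕ)
open import Data.List using (List; map; allFin)
open import Data.Nat.ListAction using (sum)
open import Data.Empty using (⊥)
open import Relation.Binary.PropositionalEquality using (_≡_)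
open import Relation.Nullary.Decidable using (does)

-- Multiple arcs are impossible by construction; opposite arcs
-- u → v and v → u are allowed.
record Digraph (n : ℕ) : Set where
  field
    adj     : Fin n → Fin n → Bool
    noLoops : ∀ v → adj v v ≡ false

open Digraph public

Arc : ∀ {n} → Digraph n → Fin n → Fin n → Set
Arc G u v = adj G u v ≡ true

private
  ind : Bool → ℕ
  ind true  = 1
  ind false = 0

outDeg : ∀ {n} → Digraph n → Fin n → ℕ
outDeg {n} G v = sum (map (λ u → ind (adj G v u)) (allFin n))

inDeg : ∀ {n} → Digraph n → Fin n → ℕ
inDeg {n} G v = sum (map (λ u → ind (adj G u v)) (allFin n))

numArcs : ∀ {n} → Digraph n → ℕ
numArcs {n} G = sum (map (outDeg G) (allFin n))

Eulerian : ∀ {n} → Digraph n → Set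
Eulerian {n} G = ∀ (v : Fin n) → inDeg G v ≡ outDeg G v

record DirectedCycle {n : ℕ} (G : Digraph n) (l : ℕ) : Set where
  field
    vtx       : Fin (suc l) → Fin n
    length≥2  : 2 ≤ suc l
    distinct  : ∀ i j → vtx i ≡ vtx j → i ≡ j
    arcs      : ∀ (i : Fin l) → Arc G (vtx (inject₁ i)) (vtx (suc i))
    closing   : Arc G (vtx (fromℕ l)) (vtx zero)

HasCycleOfLength : ∀ {n} → Digraph n → ℕ → Set
HasCycleOfLength G zero    = ⊥
HasCycleOfLength G (suc l) = DirectedCycle G l

floorSqrt : ℕ → ℕ
floorSqrt zero = zero
floorSqrt (suc x) with floorSqrt x
... | r = if does (suc r * suc r ≤? suc x) then suc r else r

-- ⌊√(m/n)⌋ for n ≥ 1 (equal to ⌊√⌊m/n⌋⌋); the value for n = 0 is irrelevant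
floorSqrtDiv : ℕ → ℕ → ℕ
floorSqrtDiv m zero    = zero
floorSqrtDiv m (suc k) = floorSqrt (m / suc k)

module Submission where

-- Fix a longest path ending at each vertex v; depth v is its number of arcs.
-- An arc u → w back onto the path to u, landing k or more steps before u,
-- closes a cycle of length ≥ k + 2.  If no arc lands that far ("short
-- chords"), each vertex has at most k out-arcs that do not climb in depth,
-- and such an arc descends by at most k.  Since G is Eulerian, a potential
-- summed over heads and over tails of all arcs agrees, which bounds
-- m ≤ (k+1) n k.  Ranking vertices by depth, cut balance at every rank and
-- Cauchy–Schwarz bound the forward arcs by the at most n k backward ones,
-- giving m² ≤ 6 n³ k.  Hence, descending from a large K, either a cycle of
-- length ≥ K exists or K - 1 satisfies both bounds as well.

open import Defs
open import Data.Nat using (ℕ; zero; suc; _+_; _*_; _^_; _⊓_; _≤_; _<_; _∸_; z≤n; s≤s; _≤?_; _<?_; s≤s⁻¹)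
open import Data.Nat.Properties
open import Data.Nat.DivMod using (_/_; m<n*o⇒m/o<n)
open import Data.Nat.Tactic.RingSolver using (solve-∀)
open import Data.Bool using (Bool; true; false; _∨_; if_then_else_)
import Data.Bool.Properties as Bool
open import Data.Fin using (Fin; zero; suc; toℕ; inject₁; fromℕ; opposite)
import Data.Fin.Properties as Fin
open import Data.List
  using (List; []; _∷_; [_]; _++_; length; lookup; take; map; filter; allFin; tabulate; cartesianProductWith)
open import Data.List.Properties using (map-tabulate; map-cong; length-++; length-take; ∷ʳ-++)
open import Data.Nat.ListAction using () renaming (sum to sumᴸ)
open import Data.Vec.Functional using (Vector)
open import Data.Product using (_×_; _,_; proj₁; proj₂; ∃₂; ∃-syntax)
open import Data.List.Relation.Unary.Any using (here; there)
open import Data.List.Relation.Unary.All using (All; []; _∷_)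
import Data.List.Relation.Unary.All as All
import Data.List.Relation.Unary.All.Properties as All
import Data.List.Relation.Unary.All.Properties.Core as All using (¬Any⇒All¬)
open import Data.List.Relation.Unary.AllPairs using (AllPairs; []; _∷_)
open import Data.List.Relation.Unary.Linked using (Linked; []; [-]; _∷_)
import Data.List.Relation.Unary.Linked as Linked
open import Data.List.Relation.Unary.Unique.Propositional using (Unique)
open import Data.List.Membership.Propositional using (_∈_; _∉_)
open import Data.List.Membership.Propositional.Properties
  using (∈-cartesianProductWith⁺; ∈-allFin; ∈-lookup; ∈-∃++; ∈-filter⁺)
open import Data.List.Extrema.Nat using (argmax; argmax-all; f[xs]≤f[argmax])
open import Data.Sum using (_⊎_; inj₁; inj₂; [_,_]′)
open import Data.Empty using (⊥)
open import Function using (id)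
open import Relation.Binary.PropositionalEquality hiding ([_])
open import Relation.Binary using (tri<; tri≈; tri>)
open import Relation.Nullary using (Dec; yes; no; ¬_; does; contradiction)
open import Relation.Nullary.Decidable using (dec-true; dec-false; ¬?; _×-dec_; decidable-stable)
open import Algebra.Properties.Semiring.Sum +-*-semiring
  using (sum; sum-syntax; sum-cong-≗; ∑-distrib-+; ∑-comm; *-distribˡ-sum; *-distribʳ-sum)

∑-mono : ∀ {n} {f g : Vector ℕ n} → (∀ i → f i ≤ g i) → sum f ≤ sum g
∑-mono {zero}  f≤g = z≤n
∑-mono {suc n} f≤g = +-mono-≤ (f≤g zero) (∑-mono (λ i → f≤g (suc i)))

∑-const : ∀ n k → ∑[ i < n ] k ≡ n * k
∑-const zero    k = refl
∑-const (suc n) k = cong (k +_) (∑-const n k)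

∑-*ˡ : ∀ {n} k (f : Vector ℕ n) → ∑[ i < n ] (k * f i) ≡ k * sum f
∑-*ˡ k f = sym (*-distribˡ-sum k f)

∑∑ : ∀ {n} → (Fin n → Fin n → ℕ) → ℕ
∑∑ {n} f = ∑[ i < n ] ∑[ j < n ] f i j

∑∑-cong : ∀ {n} {f g : Fin n → Fin n → ℕ} → (∀ i j → f i j ≡ g i j) → ∑∑ f ≡ ∑∑ g
∑∑-cong f≡g = sum-cong-≗ (λ i → sum-cong-≗ (f≡g i))

∑∑-mono : ∀ {n} {f g : Fin n → Fin n → ℕ} → (∀ i j → f i j ≤ g i j) → ∑∑ f ≤ ∑∑ g
∑∑-mono f≤g = ∑-mono (λ i → ∑-mono (f≤g i))

∑∑-+ : ∀ {n} (f g : Fin n → Fin n → ℕ) → ∑∑ (λ i j → f i j + g i j) ≡ ∑∑ f + ∑∑ g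
∑∑-+ {n} f g = trans (sum-cong-≗ (λ i → ∑-distrib-+ (f i) (g i)))
                     (∑-distrib-+ (λ i → ∑[ j < n ] f i j) (λ i → ∑[ j < n ] g i j))

∑∑-*ˡ : ∀ {n} k (f : Fin n → Fin n → ℕ) → ∑∑ (λ i j → k * f i j) ≡ k * ∑∑ f
∑∑-*ˡ {n} k f = trans (sum-cong-≗ (λ i → ∑-*ˡ k (f i))) (∑-*ˡ k (λ i → ∑[ j < n ] f i j))

∑∑-swap : ∀ {n} (f : Fin n → Fin n → ℕ) → ∑∑ f ≡ ∑∑ (λ i j → f j i)
∑∑-swap f = ∑-comm f

sumᴸ-allFin : ∀ {n} (f : Fin n → ℕ) → sumᴸ (map f (allFin n)) ≡ sum f
sumᴸ-allFin f = trans (cong sumᴸ (map-tabulate id f)) (sum-tabulate f)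
  where
  sum-tabulate : ∀ {n} (f : Fin n → ℕ) → sumᴸ (tabulate f) ≡ sum f
  sum-tabulate {zero}  f = refl
  sum-tabulate {suc n} f = cong (f zero +_) (sum-tabulate (λ i → f (suc i)))

∑-square : ∀ {n} (f : Vector ℕ n) → sum f * sum f ≡ ∑∑ (λ i j → f i * f j)
∑-square f = trans (*-distribʳ-sum (sum f) f) (sum-cong-≗ (λ i → *-distribˡ-sum (f i) f))

2ab≤a²+b² : ∀ a b → 2 * (a * b) ≤ a * a + b * b
2ab≤a²+b² a b with ≤-total b a
... | inj₁ b≤a with d , refl ← m≤n⇒∃[o]m+o≡n b≤a =
  ≤-trans (m≤m+n _ (d * d)) (≤-reflexive (identity b d))
  where
  identity : ∀ b d → 2 * ((b + d) * b) + d * d ≡ (b + d) * (b + d) + b * b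
  identity = solve-∀
... | inj₂ a≤b with d , refl ← m≤n⇒∃[o]m+o≡n a≤b =
  ≤-trans (m≤m+n _ (d * d)) (≤-reflexive (identity a d))
  where
  identity : ∀ a d → 2 * (a * (a + d)) + d * d ≡ a * a + (a + d) * (a + d)
  identity = solve-∀

-- Cauchy–Schwarz: (∑ f)² ≤ n · ∑ f², summing 2 f(i) f(j) ≤ f(i)² + f(j)².
cauchy-schwarz : ∀ {n} (f : Vector ℕ n) → sum f * sum f ≤ n * ∑[ i < n ] (f i * f i)
cauchy-schwarz {n} f = *-cancelˡ-≤ 2 (begin
  2 * (sum f * sum f)                           ≡⟨ cong (2 *_) (∑-square f) ⟩
  2 * ∑∑ (λ i j → f i * f j)                    ≡⟨ sym (∑∑-*ˡ 2 (λ i j → f i * f j)) ⟩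
  ∑∑ (λ i j → 2 * (f i * f j))                  ≤⟨ ∑∑-mono (λ i j → 2ab≤a²+b² (f i) (f j)) ⟩
  ∑∑ (λ i j → f i * f i + f j * f j)            ≡⟨ ∑∑-+ (λ i _ → f i * f i) (λ _ j → f j * f j) ⟩
  ∑∑ (λ i _ → f i * f i) + ∑∑ (λ _ j → f j * f j) ≡⟨ cong₂ _+_ rows (∑-const n S) ⟩
  n * S + n * S                                 ≡⟨ cong (n * S +_) (sym (+-identityʳ (n * S))) ⟩
  2 * (n * S)                                   ∎)
  where
  open ≤-Reasoning
  S : ℕ
  S = ∑[ i < n ] (f i * f i)
  rows : ∑∑ (λ i _ → f i * f i) ≡ n * S
  rows = trans (sum-cong-≗ (λ i → ∑-const n (f i * f i))) (∑-*ˡ n (λ i → f i * f i))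

square-of-sum : ∀ F B N → F * F ≤ 2 * (N * B) → B ≤ N → (F + B) * (F + B) ≤ 6 * (N * B)
square-of-sum F B N F²≤ B≤N = begin
  (F + B) * (F + B)                  ≡⟨ expand F B ⟩
  F * F + B * B + 2 * (F * B)        ≤⟨ +-monoʳ-≤ (F * F + B * B) (2ab≤a²+b² F B) ⟩
  F * F + B * B + (F * F + B * B)    ≡⟨ regroup F B ⟩
  2 * (F * F) + 2 * (B * B)          ≤⟨ +-mono-≤ (*-monoʳ-≤ 2 F²≤) (*-monoʳ-≤ 2 (*-monoˡ-≤ B B≤N)) ⟩
  2 * (2 * (N * B)) + 2 * (N * B)    ≡⟨ collect (N * B) ⟩
  6 * (N * B)                        ∎
  where
  open ≤-Reasoning
  expand : ∀ F B → (F + B) * (F + B) ≡ F * F + B * B + 2 * (F * B)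
  expand = solve-∀
  regroup : ∀ F B → F * F + B * B + (F * F + B * B) ≡ 2 * (F * F) + 2 * (B * B)
  regroup = solve-∀
  collect : ∀ x → 2 * (2 * x) + 2 * x ≡ 6 * x
  collect = solve-∀

ι : Bool → ℕ
ι true  = 1
ι false = 0

ι≤1 : ∀ b → ι b ≤ 1
ι≤1 true  = s≤s z≤n
ι≤1 false = z≤n

ι-∨ : ∀ b c → ι (b ∨ c) ≤ ι b + ι c
ι-∨ true  c = s≤s z≤n
ι-∨ false c = ≤-refl

𝟙 : ∀ {p} {P : Set p} → Dec P → ℕ
𝟙 d = ι (does d)

𝟙-yes : ∀ {p} {P : Set p} (d : Dec P) → P → 𝟙 d ≡ 1
𝟙-yes d p = cong ι (dec-true d p)

𝟙-no : ∀ {p} {P : Set p} (d : Dec P) → ¬ P → 𝟙 d ≡ 0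
𝟙-no d ¬p = cong ι (dec-false d ¬p)

𝟙≤1 : ∀ {p} {P : Set p} (d : Dec P) → 𝟙 d ≤ 1
𝟙≤1 d = ι≤1 (does d)

𝟙-¬ : ∀ {p} {P : Set p} (d : Dec P) → 𝟙 d + 𝟙 (¬? d) ≡ 1
𝟙-¬ (yes _) = refl
𝟙-¬ (no _)  = refl

𝟙-∧ : ∀ {p q t} {P : Set p} {Q : Set q} {T : Set t} (d : Dec P) (e : Dec Q) (f : Dec T) →
      (P → Q → T) → 𝟙 d * 𝟙 e ≤ 𝟙 f
𝟙-∧ (yes p) (yes q) f p→q→t = ≤-reflexive (sym (𝟙-yes f (p→q→t p q)))
𝟙-∧ (yes _) (no _)  f _     = z≤n
𝟙-∧ (no _)  _       f _     = z≤n

𝟙-mono : ∀ {p q} {P : Set p} {Q : Set q} (d : Dec P) (e : Dec Q) → (P → Q) → 𝟙 d ≤ 𝟙 e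
𝟙-mono (yes p) e p→q = ≤-reflexive (sym (𝟙-yes e (p→q p)))
𝟙-mono (no _)  e _   = z≤n

∑-δ : ∀ {n} (x : Fin n) (f : Fin n → ℕ) → ∑[ i < n ] (𝟙 (i Fin.≟ x) * f i) ≡ f x
∑-δ {suc n} zero    f =
  trans (cong₂ _+_ (+-identityʳ (f zero)) (trans (∑-const n 0) (*-zeroʳ n))) (+-identityʳ (f zero))
∑-δ {suc n} (suc x) f = ∑-δ x (λ i → f (suc i))

∑-δ-count : ∀ {n} (x : Fin n) → ∑[ i < n ] 𝟙 (i Fin.≟ x) ≡ 1
∑-δ-count x = trans (sum-cong-≗ (λ i → sym (*-identityʳ (𝟙 (i Fin.≟ x))))) (∑-δ x (λ _ → 1))

-- Digraphs as 0/1 adjacency matrices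

-- `Defs` counts arcs with a private Boolean indicator.  It is exposed as
-- the in-degree of the second vertex of a graph with at most one arc.
singleArc : Bool → Digraph 2
singleArc b = record { adj = arc ; noLoops = loopless }
  where
  arc : Fin 2 → Fin 2 → Bool
  arc zero (suc zero) = b
  arc _    _          = false
  loopless : ∀ v → arc v v ≡ false
  loopless zero       = refl
  loopless (suc zero) = refl

singleArc-inDeg : ∀ b → inDeg (singleArc b) (suc zero) ≡ ι b
singleArc-inDeg true  = refl
singleArc-inDeg false = refl

module AdjacencyMatrix {n : ℕ} (G : Digraph n) where

  a : Fin n → Fin n → ℕ
  a u w = ι (adj G u w)

  a≤1 : ∀ u w → a u w ≤ 1
  a≤1 u w = ι≤1 (adj G u w)

  a-loop : ∀ v → a v v ≡ 0
  a-loop v = cong ι (noLoops G v)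

  arc-irreflexive : ∀ {u w} → Arc G u w → w ≢ u
  arc-irreflexive {u} arc refl with () ← trans (sym arc) (noLoops G u)

  outDeg-∑ : ∀ v → outDeg G v ≡ ∑[ w < n ] a v w
  outDeg-∑ v = trans (cong sumᴸ (map-cong (λ w → trans (sym (+-identityʳ _)) (singleArc-inDeg (adj G v w))) (allFin n)))
                     (sumᴸ-allFin (a v))

  inDeg-∑ : ∀ w → inDeg G w ≡ ∑[ u < n ] a u w
  inDeg-∑ w = trans (cong sumᴸ (map-cong (λ u → trans (sym (+-identityʳ _)) (singleArc-inDeg (adj G u w))) (allFin n)))
                    (sumᴸ-allFin (λ u → a u w))

  numArcs-∑ : numArcs G ≡ ∑∑ a
  numArcs-∑ = trans (cong sumᴸ (map-cong outDeg-∑ (allFin n))) (sumᴸ-allFin (λ u → ∑[ w < n ] a u w))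

  arcSum : (Fin n → Fin n → ℕ) → ℕ
  arcSum h = ∑∑ (λ u w → a u w * h u w)

  arcSum-cong : ∀ {h k} → (∀ u w → h u w ≡ k u w) → arcSum h ≡ arcSum k
  arcSum-cong h≡k = ∑∑-cong (λ u w → cong (a u w *_) (h≡k u w))

  arcSum-mono : ∀ {h k} → (∀ u w → Arc G u w → h u w ≤ k u w) → arcSum h ≤ arcSum k
  arcSum-mono {h} {k} h≤k = ∑∑-mono on-arc
    where
    on-arc : ∀ u w → a u w * h u w ≤ a u w * k u w
    on-arc u w with adj G u w in arc
    ... | false = z≤n
    ... | true  = *-monoʳ-≤ 1 (h≤k u w arc)

  arcSum-cong-on-arcs : ∀ {h k} → (∀ u w → Arc G u w → h u w ≡ k u w) → arcSum h ≡ arcSum k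
  arcSum-cong-on-arcs h≡k = ≤-antisym (arcSum-mono (λ u w arc → ≤-reflexive (h≡k u w arc)))
                                      (arcSum-mono (λ u w arc → ≤-reflexive (sym (h≡k u w arc))))

  arcSum-+ : ∀ h k → arcSum (λ u w → h u w + k u w) ≡ arcSum h + arcSum k
  arcSum-+ h k = trans (∑∑-cong (λ u w → *-distribˡ-+ (a u w) (h u w) (k u w)))
                       (∑∑-+ (λ u w → a u w * h u w) (λ u w → a u w * k u w))

  arcSum-*ˡ : ∀ c h → arcSum (λ u w → c * h u w) ≡ c * arcSum h
  arcSum-*ˡ c h = trans (∑∑-cong (λ u w → x*[c*y]≡c*[x*y] (a u w) c (h u w)))
                        (∑∑-*ˡ c (λ u w → a u w * h u w))
    where
    x*[c*y]≡c*[x*y] : ∀ x c y → x * (c * y) ≡ c * (x * y)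
    x*[c*y]≡c*[x*y] = solve-∀

  numArcs-arcSum : numArcs G ≡ arcSum (λ _ _ → 1)
  numArcs-arcSum = trans numArcs-∑ (∑∑-cong (λ u w → sym (*-identityʳ (a u w))))

  -- In an Eulerian digraph every vertex is the head of as many arcs as it is
  -- the tail of, so a vertex weight summed over heads equals it summed over tails.
  flow-balance : Eulerian G → ∀ (φ : Fin n → ℕ) → arcSum (λ _ w → φ w) ≡ arcSum (λ u _ → φ u)
  flow-balance eulerian φ = begin
    ∑∑ (λ u w → a u w * φ w)             ≡⟨ ∑∑-swap (λ u w → a u w * φ w) ⟩
    ∑[ w < n ] ∑[ u < n ] (a u w * φ w)  ≡⟨ sum-cong-≗ (λ w → sum-cong-≗ (λ u → *-comm (a u w) (φ w))) ⟩
    ∑[ w < n ] ∑[ u < n ] (φ w * a u w)  ≡⟨ sum-cong-≗ (λ w → ∑-*ˡ (φ w) (λ u → a u w)) ⟩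
    ∑[ w < n ] (φ w * ∑[ u < n ] a u w)  ≡⟨ sum-cong-≗ (λ w → cong (φ w *_) in≡out) ⟩
    ∑[ w < n ] (φ w * ∑[ u < n ] a w u)  ≡⟨ sum-cong-≗ (λ w → sym (∑-*ˡ (φ w) (a w))) ⟩
    ∑[ w < n ] ∑[ u < n ] (φ w * a w u)  ≡⟨ sum-cong-≗ (λ w → sum-cong-≗ (λ u → *-comm (φ w) (a w u))) ⟩
    ∑∑ (λ w u → a w u * φ w)             ∎
    where
    open ≡-Reasoning
    in≡out : ∀ {w} → ∑[ u < n ] a u w ≡ ∑[ u < n ] a w u
    in≡out {w} = trans (sym (inDeg-∑ w)) (trans (eulerian w) (outDeg-∑ w))

  potential-bound : Eulerian G → ∀ (φ : Fin n → ℕ) (g : Fin n → Fin n → ℕ) →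
    (∀ u w → Arc G u w → φ u + 1 ≤ φ w + g u w) → numArcs G ≤ arcSum g
  potential-bound eulerian φ g rise = +-cancelˡ-≤ (arcSum (λ u _ → φ u)) _ _ (begin
    arcSum (λ u _ → φ u) + numArcs G       ≡⟨ cong (arcSum (λ u _ → φ u) +_) numArcs-arcSum ⟩
    arcSum (λ u _ → φ u) + arcSum (λ _ _ → 1)  ≡⟨ sym (arcSum-+ (λ u _ → φ u) (λ _ _ → 1)) ⟩
    arcSum (λ u _ → φ u + 1)               ≤⟨ arcSum-mono rise ⟩
    arcSum (λ u w → φ w + g u w)           ≡⟨ arcSum-+ (λ _ w → φ w) g ⟩
    arcSum (λ _ w → φ w) + arcSum g        ≡⟨ cong (_+ arcSum g) (flow-balance eulerian φ) ⟩
    arcSum (λ u _ → φ u) + arcSum g        ∎)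
    where open ≤-Reasoning

  -- Cut balance: if p and q = 1 - p describe a vertex set S and its complement,
  -- then as many arcs leave S as enter it.
  cut-balance : Eulerian G → ∀ (p q : Fin n → ℕ) → (∀ v → p v + q v ≡ 1) →
    arcSum (λ u w → p u * q w) ≡ arcSum (λ u w → q u * p w)
  cut-balance eulerian p q p+q≡1 = +-cancelˡ-≡ (arcSum inside) _ _ (begin
    arcSum inside + arcSum (λ u w → p u * q w)  ≡⟨ sym (arcSum-+ inside (λ u w → p u * q w)) ⟩
    arcSum (λ u w → p u * p w + p u * q w)      ≡⟨ arcSum-cong (λ u w → split (p u) (p w) (q w) (p+q≡1 w)) ⟩
    arcSum (λ u _ → p u)                        ≡⟨ sym (flow-balance eulerian p) ⟩
    arcSum (λ _ w → p w)                        ≡⟨ arcSum-cong (λ u w → split′ (p w) (p u) (q u) (p+q≡1 u)) ⟩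
    arcSum (λ u w → p u * p w + q u * p w)      ≡⟨ arcSum-+ inside (λ u w → q u * p w) ⟩
    arcSum inside + arcSum (λ u w → q u * p w)  ∎)
    where
    open ≡-Reasoning
    inside : Fin n → Fin n → ℕ
    inside u w = p u * p w
    split : ∀ x y z → y + z ≡ 1 → x * y + x * z ≡ x
    split x y z y+z≡1 = trans (sym (*-distribˡ-+ x y z)) (trans (cong (x *_) y+z≡1) (*-identityʳ x))
    split′ : ∀ x y z → y + z ≡ 1 → x ≡ y * x + z * x
    split′ x y z y+z≡1 = trans (sym (*-identityˡ x)) (trans (cong (_* x) (sym y+z≡1)) (*-distribʳ-+ x y z))

-- Rankings of the vertices by an injective key

lexRank : ∀ {n} → (Fin n → ℕ) → Fin n → ℕ
lexRank {n} φ u = φ u * n + toℕ u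

lexRank-mono : ∀ {n} (φ : Fin n → ℕ) {u w} → φ u < φ w → lexRank φ u < lexRank φ w
lexRank-mono {n} φ {u} {w} φu<φw = begin-strict
  φ u * n + toℕ u     <⟨ +-monoʳ-< (φ u * n) (Fin.toℕ<n u) ⟩
  φ u * n + n         ≡⟨ +-comm (φ u * n) n ⟩
  suc (φ u) * n       ≤⟨ *-monoˡ-≤ n φu<φw ⟩
  φ w * n             ≤⟨ m≤m+n (φ w * n) (toℕ w) ⟩
  φ w * n + toℕ w     ∎
  where open ≤-Reasoning

lexRank-injective : ∀ {n} (φ : Fin n → ℕ) {u w} → lexRank φ u ≡ lexRank φ w → u ≡ w
lexRank-injective {n} φ {u} {w} eq with <-cmp (φ u) (φ w)
... | tri< φu<φw _ _ = contradiction eq (<⇒≢ (lexRank-mono φ φu<φw))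
... | tri> _ _ φw<φu = contradiction (sym eq) (<⇒≢ (lexRank-mono φ φw<φu))
... | tri≈ _ φu≡φw _ = Fin.toℕ-injective (+-cancelˡ-≡ (φ u * n) (toℕ u) (toℕ w)
                         (trans eq (cong (λ h → h * n + toℕ w) (sym φu≡φw))))

lexRank-below : ∀ {n} (φ : Fin n → ℕ) {u w} → lexRank φ w < lexRank φ u → φ w ≤ φ u
lexRank-below φ below = ≮⇒≥ (λ φu<φw → <-asym (lexRank-mono φ φu<φw) below)

module InjectiveRank {n : ℕ} (r : Fin n → ℕ) (r-injective : ∀ {u v} → r u ≡ r v → u ≡ v) where

  _≺?_ : (u v : Fin n) → Dec (r u < r v)
  u ≺? v = r u <? r v

  trichotomy : ∀ u v → 𝟙 (u ≺? v) + 𝟙 (v ≺? u) + 𝟙 (v Fin.≟ u) ≡ 1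
  trichotomy u v with <-cmp (r u) (r v)
  ... | tri< u≺v _ _ = cong₂ _+_ (cong₂ _+_ (𝟙-yes (u ≺? v) u≺v) (𝟙-no (v ≺? u) (<-asym u≺v)))
                                 (𝟙-no (v Fin.≟ u) (λ { refl → <-irrefl refl u≺v }))
  ... | tri> _ _ v≺u = cong₂ _+_ (cong₂ _+_ (𝟙-no (u ≺? v) (<-asym v≺u)) (𝟙-yes (v ≺? u) v≺u))
                                 (𝟙-no (v Fin.≟ u) (λ { refl → <-irrefl refl v≺u }))
  ... | tri≈ _ r≡ _  = cong₂ _+_ (cong₂ _+_ (𝟙-no (u ≺? v) (<-irrefl r≡)) (𝟙-no (v ≺? u) (<-irrefl (sym r≡))))
                                 (𝟙-yes (v Fin.≟ u) (sym (r-injective r≡)))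

  square≤pairs : ∀ (s : Fin n → ℕ) →
    sum s * sum s ≤ 2 * ∑[ u < n ] (s u * (s u + ∑[ y < n ] (s y * 𝟙 (u ≺? y))))
  square≤pairs s = begin
    sum s * sum s                                 ≡⟨ ∑-square s ⟩
    ∑∑ (λ u y → s u * s y)                        ≡⟨ ∑∑-cong split ⟩
    ∑∑ (λ u y → below u y + below y u + diagonal u y)
      ≡⟨ trans (∑∑-+ (λ u y → below u y + below y u) diagonal)
               (cong (_+ ∑∑ diagonal) (∑∑-+ below (λ u y → below y u))) ⟩
    ∑∑ below + ∑∑ (λ u y → below y u) + ∑∑ diagonal
      ≡⟨ cong₂ (λ x z → ∑∑ below + x + z) (sym (∑∑-swap below)) diagonal-sum ⟩
    ∑∑ below + ∑∑ below + D                       ≤⟨ m≤m+n (∑∑ below + ∑∑ below + D) D ⟩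
    ∑∑ below + ∑∑ below + D + D                   ≡⟨ double (∑∑ below) D ⟩
    2 * (D + ∑∑ below)                            ≡⟨ cong (2 *_) (sym regroup) ⟩
    2 * ∑[ u < n ] (s u * (s u + ∑[ y < n ] (s y * 𝟙 (u ≺? y)))) ∎
    where
    open ≤-Reasoning
    below diagonal : Fin n → Fin n → ℕ
    below u y = s u * (s y * 𝟙 (u ≺? y))
    diagonal u y = s u * s y * 𝟙 (y Fin.≟ u)
    D : ℕ
    D = ∑[ u < n ] (s u * s u)
    expand : ∀ a b p q t → a * b * (p + q + t) ≡ a * (b * p) + b * (a * q) + a * b * t
    expand = solve-∀
    split : ∀ u y → s u * s y ≡ below u y + below y u + diagonal u y
    split u y = trans (sym (trans (cong (s u * s y *_) (trichotomy u y)) (*-identityʳ (s u * s y))))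
                      (expand (s u) (s y) (𝟙 (u ≺? y)) (𝟙 (y ≺? u)) (𝟙 (y Fin.≟ u)))
    diagonal-sum : ∑∑ diagonal ≡ D
    diagonal-sum = sum-cong-≗ (λ u → trans (sum-cong-≗ (λ y → *-comm (s u * s y) (𝟙 (y Fin.≟ u))))
                                           (∑-δ u (λ y → s u * s y)))
    double : ∀ x d → x + x + d + d ≡ 2 * (d + x)
    double = solve-∀
    regroup : ∑[ u < n ] (s u * (s u + ∑[ y < n ] (s y * 𝟙 (u ≺? y)))) ≡ D + ∑∑ below
    regroup = trans (sum-cong-≗ (λ u → trans (*-distribˡ-+ (s u) (s u) _)
                                            (cong (s u * s u +_) (*-distribˡ-sum (s u) (λ y → s y * 𝟙 (u ≺? y))))))
                    (∑-distrib-+ (λ u → s u * s u) (λ u → ∑[ y < n ] below u y))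

  module RankedArcs (G : Digraph n) (eulerian : Eulerian G) where
    open AdjacencyMatrix G

    forwardArcs backwardArcs : ℕ
    forwardArcs  = arcSum (λ u w → 𝟙 (u ≺? w))
    backwardArcs = arcSum (λ u w → 𝟙 (w ≺? u))

    arcs-split : numArcs G ≡ forwardArcs + backwardArcs
    arcs-split = trans numArcs-arcSum (trans (arcSum-cong-on-arcs split) (arcSum-+ _ _))
      where
      split : ∀ u w → Arc G u w → 1 ≡ 𝟙 (u ≺? w) + 𝟙 (w ≺? u)
      split u w arc = begin
        1                                                 ≡⟨ sym (trichotomy u w) ⟩
        𝟙 (u ≺? w) + 𝟙 (w ≺? u) + 𝟙 (w Fin.≟ u)
          ≡⟨ cong (𝟙 (u ≺? w) + 𝟙 (w ≺? u) +_) (𝟙-no (w Fin.≟ u) (arc-irreflexive arc)) ⟩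
        𝟙 (u ≺? w) + 𝟙 (w ≺? u) + 0                      ≡⟨ +-identityʳ _ ⟩
        𝟙 (u ≺? w) + 𝟙 (w ≺? u)                          ∎
        where open ≡-Reasoning

    backward≤n² : backwardArcs ≤ n * n
    backward≤n² = begin
      backwardArcs                ≤⟨ ∑∑-mono (λ u w → *-mono-≤ (a≤1 u w) (𝟙≤1 (w ≺? u))) ⟩
      ∑[ u < n ] ∑[ w < n ] 1     ≡⟨ ∑-const n (∑[ w < n ] 1) ⟩
      n * ∑[ w < n ] 1            ≡⟨ cong (n *_) (trans (∑-const n 1) (*-identityʳ n)) ⟩
      n * n                       ∎
      where open ≤-Reasoning

    upCrossing downCrossing : Fin n → ℕ
    upCrossing y   = arcSum (λ u w → 𝟙 (u ≺? y) * 𝟙 (¬? (w ≺? y)))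
    downCrossing y = arcSum (λ u w → 𝟙 (¬? (u ≺? y)) * 𝟙 (w ≺? y))

    up≡down : ∀ y → upCrossing y ≡ downCrossing y
    up≡down y = cut-balance eulerian (λ v → 𝟙 (v ≺? y)) (λ v → 𝟙 (¬? (v ≺? y))) (λ v → 𝟙-¬ (v ≺? y))

    down≤backward : ∀ y → downCrossing y ≤ backwardArcs
    down≤backward y = arcSum-mono (λ u w _ → crosses u w)
      where
      crosses : ∀ u w → 𝟙 (¬? (u ≺? y)) * 𝟙 (w ≺? y) ≤ 𝟙 (w ≺? u)
      crosses u w = 𝟙-∧ (¬? (u ≺? y)) (w ≺? y) (w ≺? u) (λ u⊀y w≺y → <-≤-trans w≺y (≮⇒≥ u⊀y))

    forwardTail : Fin n → Fin n → ℕ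
    forwardTail w u = a u w * 𝟙 (u ≺? w)

    forwardIn : Fin n → ℕ
    forwardIn w = ∑[ u < n ] forwardTail w u

    forwardTail≤a : ∀ w u → forwardTail w u ≤ a u w
    forwardTail≤a w u = ≤-trans (*-monoʳ-≤ (a u w) (𝟙≤1 (u ≺? w))) (≤-reflexive (*-identityʳ (a u w)))

    forwardTail≤1 : ∀ w u → forwardTail w u ≤ 1
    forwardTail≤1 w u = ≤-trans (forwardTail≤a w u) (a≤1 u w)

    forwardTail-above : ∀ w u → ¬ (r u < r w) → forwardTail w u ≡ 0
    forwardTail-above w u u⊀w = trans (cong (a u w *_) (𝟙-no (u ≺? w) u⊀w)) (*-zeroʳ (a u w))

    -- Let u ≺ w.  The cut below y separates u from w when y = w, and when y
    -- is a higher tail of a forward arc into w.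
    separating-cuts : ∀ {u w} → r u < r w → ∀ y →
      𝟙 (y Fin.≟ w) + forwardTail w y * 𝟙 (u ≺? y) ≤ 𝟙 (u ≺? y) * 𝟙 (¬? (w ≺? y))
    separating-cuts {u} {w} u≺w y with y Fin.≟ w | y ≺? w
    ... | yes refl | _ = ≤-reflexive (begin
      1 + forwardTail w w * 𝟙 (u ≺? w)  ≡⟨ cong (λ x → 1 + x * 𝟙 (w ≺? w) * 𝟙 (u ≺? w)) (a-loop w) ⟩
      1                                 ≡⟨ sym (cong₂ _*_ (𝟙-yes (u ≺? w) u≺w) (𝟙-yes (¬? (w ≺? w)) (<-irrefl refl))) ⟩
      𝟙 (u ≺? w) * 𝟙 (¬? (w ≺? w))      ∎)
      where open ≡-Reasoning
    ... | no _ | yes y≺w = begin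
      forwardTail w y * 𝟙 (u ≺? y)      ≤⟨ *-monoˡ-≤ (𝟙 (u ≺? y)) (forwardTail≤1 w y) ⟩
      1 * 𝟙 (u ≺? y)                    ≡⟨ *-comm 1 (𝟙 (u ≺? y)) ⟩
      𝟙 (u ≺? y) * 1                    ≡⟨ cong (𝟙 (u ≺? y) *_) (sym (𝟙-yes (¬? (w ≺? y)) (<-asym y≺w))) ⟩
      𝟙 (u ≺? y) * 𝟙 (¬? (w ≺? y))      ∎
      where open ≤-Reasoning
    ... | no _ | no y⊀w = ≤-trans (≤-reflexive (cong (_* 𝟙 (u ≺? y)) (forwardTail-above w y y⊀w))) z≤n

    separations : Fin n → Fin n → ℕ
    separations u w = ∑[ y < n ] (𝟙 (u ≺? y) * 𝟙 (¬? (w ≺? y)))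

    -- The f forward arcs into w separate at least f(f+1)/2 cuts in total: the
    -- i-th highest tail is separated from w by the cuts below the i - 1 higher
    -- tails and below w itself.
    forwardIn² : ∀ w → forwardIn w * forwardIn w ≤ 2 * ∑[ u < n ] (a u w * separations u w)
    forwardIn² w = ≤-trans (square≤pairs (forwardTail w)) (*-monoʳ-≤ 2 (∑-mono per-tail))
      where
      higherTails : Fin n → ℕ
      higherTails u = ∑[ y < n ] (forwardTail w y * 𝟙 (u ≺? y))
      per-tail : ∀ u → forwardTail w u * (forwardTail w u + higherTails u) ≤ a u w * separations u w
      per-tail u with u ≺? w
      ... | no  u⊀w =
        ≤-trans (≤-reflexive (cong (_* (forwardTail w u + higherTails u)) (forwardTail-above w u u⊀w))) z≤n
      ... | yes u≺w = *-mono-≤ (forwardTail≤a w u) (begin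
        forwardTail w u + higherTails u                        ≤⟨ +-monoˡ-≤ (higherTails u) (forwardTail≤1 w u) ⟩
        1 + higherTails u                                      ≡⟨ cong (_+ higherTails u) (sym (∑-δ-count w)) ⟩
        ∑[ y < n ] 𝟙 (y Fin.≟ w) + higherTails u
          ≡⟨ sym (∑-distrib-+ (λ y → 𝟙 (y Fin.≟ w)) (λ y → forwardTail w y * 𝟙 (u ≺? y))) ⟩
        ∑[ y < n ] (𝟙 (y Fin.≟ w) + forwardTail w y * 𝟙 (u ≺? y)) ≤⟨ ∑-mono (separating-cuts u≺w) ⟩
        separations u w                                        ∎)
        where open ≤-Reasoning

    -- Every forward arc is counted by the cuts it crosses; by cut balance
    -- each cut is crossed by at most backwardArcs arcs in the other direction.
    ∑forwardIn² : ∑[ w < n ] (forwardIn w * forwardIn w) ≤ 2 * (n * backwardArcs)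
    ∑forwardIn² = begin
      ∑[ w < n ] (forwardIn w * forwardIn w)     ≤⟨ ∑-mono forwardIn² ⟩
      ∑[ w < n ] (2 * ∑[ u < n ] (a u w * separations u w))
        ≡⟨ ∑-*ˡ 2 (λ w → ∑[ u < n ] (a u w * separations u w)) ⟩
      2 * ∑[ w < n ] ∑[ u < n ] (a u w * separations u w) ≡⟨ cong (2 *_) reorder ⟩
      2 * ∑[ y < n ] upCrossing y                ≡⟨ cong (2 *_) (sum-cong-≗ up≡down) ⟩
      2 * ∑[ y < n ] downCrossing y              ≤⟨ *-monoʳ-≤ 2 (∑-mono down≤backward) ⟩
      2 * ∑[ y < n ] backwardArcs                ≡⟨ cong (2 *_) (∑-const n backwardArcs) ⟩
      2 * (n * backwardArcs)                     ∎
      where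
      open ≤-Reasoning
      c : Fin n → Fin n → Fin n → ℕ
      c u w y = 𝟙 (u ≺? y) * 𝟙 (¬? (w ≺? y))
      reorder : ∑[ w < n ] ∑[ u < n ] (a u w * separations u w) ≡ ∑[ y < n ] upCrossing y
      reorder = begin-equality
        ∑[ w < n ] ∑[ u < n ] (a u w * separations u w)
          ≡⟨ sum-cong-≗ (λ w → sum-cong-≗ (λ u → *-distribˡ-sum (a u w) (c u w))) ⟩
        ∑[ w < n ] ∑[ u < n ] ∑[ y < n ] (a u w * c u w y) ≡⟨ ∑-comm (λ w u → ∑[ y < n ] (a u w * c u w y)) ⟩
        ∑[ u < n ] ∑[ w < n ] ∑[ y < n ] (a u w * c u w y) ≡⟨ sum-cong-≗ (λ u → ∑-comm (λ w y → a u w * c u w y)) ⟩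
        ∑[ u < n ] ∑[ y < n ] ∑[ w < n ] (a u w * c u w y) ≡⟨ ∑-comm (λ u y → ∑[ w < n ] (a u w * c u w y)) ⟩
        ∑[ y < n ] upCrossing y                            ∎

    forward² : forwardArcs * forwardArcs ≤ 2 * ((n * n) * backwardArcs)
    forward² = begin
      forwardArcs * forwardArcs                          ≡⟨ cong (λ x → x * x) (∑∑-swap (λ u w → forwardTail w u)) ⟩
      sum forwardIn * sum forwardIn                      ≤⟨ cauchy-schwarz forwardIn ⟩
      n * ∑[ w < n ] (forwardIn w * forwardIn w)         ≤⟨ *-monoʳ-≤ n ∑forwardIn² ⟩
      n * (2 * (n * backwardArcs))                       ≡⟨ reassociate n backwardArcs ⟩
      2 * ((n * n) * backwardArcs)                       ∎
      where
      open ≤-Reasoning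
      reassociate : ∀ n b → n * (2 * (n * b)) ≡ 2 * ((n * n) * b)
      reassociate = solve-∀

    numArcs²≤backward : numArcs G * numArcs G ≤ 6 * ((n * n) * backwardArcs)
    numArcs²≤backward rewrite arcs-split = square-of-sum forwardArcs backwardArcs (n * n) forward² backward≤n²

module _ {ℓ} {A : Set ℓ} where

  Unique-lookup-injective : ∀ {xs : List A} → Unique xs → ∀ i j → lookup xs i ≡ lookup xs j → i ≡ j
  Unique-lookup-injective {x ∷ xs} _            zero    zero    _ = refl
  Unique-lookup-injective {x ∷ xs} (x≢xs ∷ _)   zero    (suc j) eq = contradiction eq (All.lookup x≢xs (∈-lookup j))
  Unique-lookup-injective {x ∷ xs} (x≢xs ∷ _)   (suc i) zero    eq = contradiction (sym eq) (All.lookup x≢xs (∈-lookup i))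
  Unique-lookup-injective {x ∷ xs} (_ ∷ unique) (suc i) (suc j) eq = cong suc (Unique-lookup-injective unique i j eq)

  AllPairs-++⁻ˡ : ∀ {r} {R : A → A → Set r} xs {ys} → AllPairs R (xs ++ ys) → AllPairs R xs
  AllPairs-++⁻ˡ []       _          = []
  AllPairs-++⁻ˡ (x ∷ xs) (px ∷ pxs) = All.++⁻ˡ xs px ∷ AllPairs-++⁻ˡ xs pxs

  AllPairs-++⁻ʳ : ∀ {r} {R : A → A → Set r} xs {ys} → AllPairs R (xs ++ ys) → AllPairs R ys
  AllPairs-++⁻ʳ []       pys        = pys
  AllPairs-++⁻ʳ (x ∷ xs) (_ ∷ pxs)  = AllPairs-++⁻ʳ xs pxs

  Linked-++⁻ˡ : ∀ {r} {R : A → A → Set r} xs {ys} → Linked R (xs ++ ys) → Linked R xs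
  Linked-++⁻ˡ []           _            = []
  Linked-++⁻ˡ (x ∷ [])     _            = [-]
  Linked-++⁻ˡ (x ∷ y ∷ xs) (Rxy ∷ Rxs)  = Rxy ∷ Linked-++⁻ˡ (y ∷ xs) Rxs

  Linked-++⁻ʳ : ∀ {r} {R : A → A → Set r} xs {ys} → Linked R (xs ++ ys) → Linked R ys
  Linked-++⁻ʳ []           Rys         = Rys
  Linked-++⁻ʳ (x ∷ [])     Rys         = Linked.tail Rys
  Linked-++⁻ʳ (x ∷ y ∷ xs) (_ ∷ Rxs)   = Linked-++⁻ʳ (y ∷ xs) Rxs

  Linked-lookup : ∀ {r} {R : A → A → Set r} {x xs} → Linked R (x ∷ xs) →
    ∀ (j : Fin (length xs)) → R (lookup (x ∷ xs) (inject₁ j)) (lookup (x ∷ xs) (suc j))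
  Linked-lookup (Rxy ∷ _)   zero    = Rxy
  Linked-lookup (_ ∷ Rxs) (suc j) = Linked-lookup Rxs j

  lookup-last : ∀ (x : A) ys y → lookup (x ∷ ys ++ [ y ]) (fromℕ (length (ys ++ [ y ]))) ≡ y
  lookup-last x []       y = refl
  lookup-last x (z ∷ ys) y = lookup-last z ys y

  ∈-take-split : ∀ {y : A} k (xs : List A) → y ∈ take k xs → ∃₂ λ ys zs → xs ≡ ys ++ y ∷ zs × length ys < k
  ∈-take-split (suc k) (x ∷ xs) (here refl) = [] , xs , refl , s≤s z≤n
  ∈-take-split (suc k) (x ∷ xs) (there y∈)
    with ys , zs , refl , |ys|<k ← ∈-take-split k xs y∈ = x ∷ ys , zs , refl , s≤s |ys|<k

  ∈-take-prefix : ∀ {y : A} k (ys zs : List A) → length ys < k → y ∈ take k (ys ++ y ∷ zs)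
  ∈-take-prefix (suc k) []       zs _           = here refl
  ∈-take-prefix (suc k) (x ∷ ys) zs (s≤s |ys|<k) = there (∈-take-prefix k ys zs |ys|<k)

  words : List A → ℕ → List (List A)
  words univ zero    = [ [] ]
  words univ (suc k) = [] ∷ cartesianProductWith _∷_ univ (words univ k)

  words-complete : ∀ {univ} → (∀ x → x ∈ univ) → ∀ k xs → length xs ≤ k → xs ∈ words univ k
  words-complete complete zero    []       _          = here refl
  words-complete complete (suc k) []       _          = here refl
  words-complete complete (suc k) (x ∷ xs) (s≤s |xs|≤k) =
    there (∈-cartesianProductWith⁺ _∷_ (complete x) (words-complete complete k xs |xs|≤k))

Fin-opposite-inject₁ : ∀ {k} (i : Fin k) → opposite (inject₁ i) ≡ suc (opposite i)
Fin-opposite-inject₁ {suc k} zero    = refl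
Fin-opposite-inject₁ {suc k} (suc i) = cong inject₁ (Fin-opposite-inject₁ i)

Fin-opposite-fromℕ : ∀ k → opposite (fromℕ k) ≡ zero
Fin-opposite-fromℕ zero    = refl
Fin-opposite-fromℕ (suc k) = cong inject₁ (Fin-opposite-fromℕ k)

Unique-length : ∀ {n} {xs : List (Fin n)} → Unique xs → length xs ≤ n
Unique-length {n} {xs} unique = ≮⇒≥ too-long
  where
  too-long : n < length xs → ⊥
  too-long n<|xs| with i , j , i<j , eq ← Fin.pigeonhole n<|xs| (lookup xs) =
    <-irrefl (cong toℕ (Unique-lookup-injective unique i j eq)) i<j

module VertexLists {n : ℕ} where
  open import Data.List.Membership.DecPropositional (Fin._≟_ {n}) public using (_∈?_)
  open import Data.List.Relation.Unary.Unique.DecPropositional (Fin._≟_ {n}) public using (unique?)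

  ∑-∈≤length : ∀ (xs : List (Fin n)) → ∑[ w < n ] 𝟙 (w ∈? xs) ≤ length xs
  ∑-∈≤length []       = ≤-reflexive (trans (∑-const n 0) (*-zeroʳ n))
  ∑-∈≤length (x ∷ xs) = begin
    ∑[ w < n ] 𝟙 (w ∈? x ∷ xs)
      ≤⟨ ∑-mono (λ w → ι-∨ (does (w Fin.≟ x)) (does (w ∈? xs))) ⟩
    ∑[ w < n ] (𝟙 (w Fin.≟ x) + 𝟙 (w ∈? xs))
      ≡⟨ ∑-distrib-+ (λ w → 𝟙 (w Fin.≟ x)) (λ w → 𝟙 (w ∈? xs)) ⟩
    ∑[ w < n ] 𝟙 (w Fin.≟ x) + ∑[ w < n ] 𝟙 (w ∈? xs)
      ≤⟨ +-mono-≤ (≤-reflexive (∑-δ-count x)) (∑-∈≤length xs) ⟩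
    suc (length xs)                                       ∎
    where open ≤-Reasoning

-- Longest paths

module LongestPaths {n : ℕ} (G : Digraph n) where
  open AdjacencyMatrix G
  open VertexLists {n}

  -- Paths are listed from their last vertex backwards: in x ∷ y ∷ … the
  -- arc runs from y to x.
  _←_ : Fin n → Fin n → Set
  x ← y = Arc G y x

  IsPath : List (Fin n) → Set
  IsPath xs = Unique xs × Linked _←_ xs

  isPath? : ∀ xs → Dec (IsPath xs)
  isPath? xs = unique? xs ×-dec Linked.linked? (λ x y → adj G y x Bool.≟ true) xs

  IsPath-++⁻ˡ : ∀ xs {ys} → IsPath (xs ++ ys) → IsPath xs
  IsPath-++⁻ˡ xs (unique , linked) = AllPairs-++⁻ˡ xs unique , Linked-++⁻ˡ xs linked

  IsPath-++⁻ʳ : ∀ xs {ys} → IsPath (xs ++ ys) → IsPath ys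
  IsPath-++⁻ʳ xs (unique , linked) = AllPairs-++⁻ʳ xs unique , Linked-++⁻ʳ xs linked

  -- The paths v ∷ xs ending at v, listed by their xs; these have at most
  -- n entries, so enumerating words of length ≤ n finds them all.
  pathsTo : Fin n → List (List (Fin n))
  pathsTo v = filter (λ xs → isPath? (v ∷ xs)) (words (allFin n) n)

  before : Fin n → List (Fin n)
  before v = argmax length [] (pathsTo v)

  depth : Fin n → ℕ
  depth v = length (before v)

  before-isPath : ∀ v → IsPath (v ∷ before v)
  before-isPath v = argmax-all length {P = λ xs → IsPath (v ∷ xs)} trivial
                                (All.all-filter (λ xs → isPath? (v ∷ xs)) (words (allFin n) n))
    where
    trivial : IsPath (v ∷ [])
    trivial = ([] ∷ []) , [-]

  depth-maximal : ∀ v xs → IsPath (v ∷ xs) → length xs ≤ depth v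
  depth-maximal v xs path =
    All.lookup (f[xs]≤f[argmax] [] (pathsTo v)) (∈-filter⁺ (λ xs → isPath? (v ∷ xs)) candidate path)
    where
    candidate : xs ∈ words (allFin n) n
    candidate = words-complete ∈-allFin n xs (≤-trans (n≤1+n _) (Unique-length (proj₁ path)))

  -- An arc into a vertex that is not deeper than its tail u must land on
  -- the longest path to u; otherwise that path could be extended.
  arc-into-path : ∀ {u w} → Arc G u w → depth w ≤ depth u → w ∈ before u
  arc-into-path {u} {w} arc w≤u = decidable-stable (w ∈? before u) off-path⇒deeper
    where
    off-path⇒deeper : w ∉ before u → ⊥
    off-path⇒deeper w∉ = <⇒≱ (s≤s w≤u) (depth-maximal w (u ∷ before u) extended)
      where
      extended : IsPath (w ∷ u ∷ before u)
      extended = (arc-irreflexive arc ∷ All.¬Any⇒All¬ (before u) w∉) ∷ proj₁ (before-isPath u)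
               , arc ∷ proj₂ (before-isPath u)

  closed-path⇒cycle : ∀ v ys w → IsPath (v ∷ ys ++ [ w ]) → Arc G v w →
    HasCycleOfLength G (2 + length ys)
  closed-path⇒cycle v ys w (unique , linked) arc =
    subst (HasCycleOfLength G) (cong suc |ys++[w]|) (record
      { vtx      = vertex
      ; length≥2 = s≤s (subst (1 ≤_) (sym |ys++[w]|) (s≤s z≤n))
      ; distinct = λ i j eq → opposite-injective (Unique-lookup-injective unique (opposite i) (opposite j) eq)
      ; arcs     = λ i → subst (λ k → Arc G (lookup cycle k) (vertex (suc i)))
                               (sym (Fin-opposite-inject₁ i)) (Linked-lookup linked (opposite i))
      ; closing  = subst₂ (Arc G) (cong (lookup cycle) (sym (Fin-opposite-fromℕ (length (ys ++ [ w ])))))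
                                  (sym (lookup-last v ys w)) arc
      })
    where
    cycle : List (Fin n)
    cycle = v ∷ ys ++ [ w ]
    -- the cycle traversed forwards: from w round to v
    vertex : Fin (suc (length (ys ++ [ w ]))) → Fin n
    vertex i = lookup cycle (opposite i)
    |ys++[w]| : length (ys ++ [ w ]) ≡ suc (length ys)
    |ys++[w]| = trans (length-++ ys) (+-comm (length ys) 1)
    opposite-injective : ∀ {k} {i j : Fin k} → opposite i ≡ opposite j → i ≡ j
    opposite-injective {i = i} {j} eq =
      trans (sym (Fin.opposite-involutive i)) (trans (cong opposite eq) (Fin.opposite-involutive j))

  chord-cycle : ∀ {u w} ys zs → Arc G u w → before u ≡ ys ++ w ∷ zs → HasCycleOfLength G (2 + length ys)
  chord-cycle {u} {w} ys zs arc split = closed-path⇒cycle u ys w (IsPath-++⁻ˡ (u ∷ ys ++ [ w ]) path) arc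
    where
    path : IsPath ((u ∷ ys ++ [ w ]) ++ zs)
    path = subst (λ xs → IsPath (u ∷ xs)) (trans split (sym (∷ʳ-++ ys w zs))) (before-isPath u)

  ShortChords : ℕ → Set
  ShortChords k = ∀ u w → Arc G u w → w ∈ before u → w ∈ take k (before u)

  LongChord : ℕ → Fin n → Fin n → Set
  LongChord k u w = Arc G u w × w ∈ before u × w ∉ take k (before u)

  long-chord? : ∀ k u w → Dec (LongChord k u w)
  long-chord? k u w = (adj G u w Bool.≟ true) ×-dec (w ∈? before u) ×-dec ¬? (w ∈? take k (before u))

  long-chord⇒cycle : ∀ {k u w} → LongChord k u w → ∃[ L ] (HasCycleOfLength G L × 2 + k ≤ L)
  long-chord⇒cycle {k} {u} {w} (arc , w∈ , w∉) with ys , zs , split ← ∈-∃++ w∈ =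
    2 + length ys , chord-cycle ys zs arc split , s≤s (s≤s (≮⇒≥ near))
    where
    near : length ys < k → ⊥
    near |ys|<k = w∉ (subst (λ xs → w ∈ take k xs) (sym split) (∈-take-prefix k ys zs |ys|<k))

  long-cycle-or-short-chords : ∀ k → (∃[ L ] (HasCycleOfLength G L × 2 + k ≤ L)) ⊎ ShortChords k
  long-cycle-or-short-chords k with Fin.any? (λ u → Fin.any? (λ w → long-chord? k u w))
  ... | yes (u , w , long) = inj₁ (long-chord⇒cycle long)
  ... | no  none = inj₂ (λ u w arc w∈ →
          decidable-stable (w ∈? take k (before u)) (λ w∉ → none (u , w , arc , w∈ , w∉)))

  descent-bound : ∀ {k} → ShortChords k → ∀ {u w} → Arc G u w → depth w ≤ depth u → depth u ≤ depth w + k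
  descent-bound {k} short {u} {w} arc w≤u
    with ys , zs , split , |ys|<k ← ∈-take-split k (before u) (short u w arc (arc-into-path arc w≤u)) = begin
      depth u                      ≡⟨ cong length split ⟩
      length (ys ++ w ∷ zs)        ≡⟨ length-++ ys ⟩
      length ys + suc (length zs)  ≡⟨ +-suc (length ys) (length zs) ⟩
      suc (length ys) + length zs  ≤⟨ +-mono-≤ |ys|<k (depth-maximal w zs suffix) ⟩
      k + depth w                  ≡⟨ +-comm k (depth w) ⟩
      depth w + k                  ∎
    where
    open ≤-Reasoning
    suffix : IsPath (w ∷ zs)
    suffix = IsPath-++⁻ʳ (u ∷ ys) (subst (λ xs → IsPath (u ∷ xs)) split (before-isPath u))

  descendingArcs : ℕ
  descendingArcs = arcSum (λ u w → 𝟙 (depth w ≤? depth u))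

  -- Each vertex u is the tail of at most k of them: their heads are among
  -- the k vertices just before u.
  descendingArcs≤ : ∀ {k} → ShortChords k → descendingArcs ≤ n * k
  descendingArcs≤ {k} short = begin
    descendingArcs                                       ≤⟨ ∑-mono out-arcs ⟩
    ∑[ u < n ] k                                         ≡⟨ ∑-const n k ⟩
    n * k                                                ∎
    where
    open ≤-Reasoning
    into-prefix : ∀ u w → a u w * 𝟙 (depth w ≤? depth u) ≤ 𝟙 (w ∈? take k (before u))
    into-prefix u w with adj G u w in arc
    ... | false = z≤n
    ... | true  = ≤-trans (≤-reflexive (*-identityˡ _))
                          (𝟙-mono (depth w ≤? depth u) (w ∈? take k (before u))
                                  (λ w≤u → short u w arc (arc-into-path arc w≤u)))
    out-arcs : ∀ u → ∑[ w < n ] (a u w * 𝟙 (depth w ≤? depth u)) ≤ k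
    out-arcs u = begin
      ∑[ w < n ] (a u w * 𝟙 (depth w ≤? depth u))  ≤⟨ ∑-mono (into-prefix u) ⟩
      ∑[ w < n ] 𝟙 (w ∈? take k (before u))        ≤⟨ ∑-∈≤length (take k (before u)) ⟩
      length (take k (before u))                   ≡⟨ length-take k (before u) ⟩
      k ⊓ depth u                                  ≤⟨ m⊓n≤m k (depth u) ⟩
      k                                            ∎

  -- First bound: m ≤ (k + 1) n k, since depth rises along every climbing arc.
  short-chords⇒numArcs≤ : ∀ {k} → Eulerian G → ShortChords k → numArcs G ≤ suc k * (n * k)
  short-chords⇒numArcs≤ {k} eulerian short = begin
    numArcs G                                 ≤⟨ potential-bound eulerian depth correction rise ⟩
    arcSum correction                         ≡⟨ arcSum-*ˡ (suc k) (λ u w → 𝟙 (depth w ≤? depth u)) ⟩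
    suc k * descendingArcs                    ≤⟨ *-monoʳ-≤ (suc k) (descendingArcs≤ short) ⟩
    suc k * (n * k)                           ∎
    where
    open ≤-Reasoning
    correction : Fin n → Fin n → ℕ
    correction u w = suc k * 𝟙 (depth w ≤? depth u)
    regroup : ∀ y k → y + k + 1 ≡ y + suc k * 1
    regroup = solve-∀
    step : ∀ {x y} (d : Dec (y ≤ x)) → (y ≤ x → x ≤ y + k) → x + 1 ≤ y + suc k * 𝟙 d
    step {x} {y} (yes y≤x) drop = begin
      x + 1              ≤⟨ +-monoˡ-≤ 1 (drop y≤x) ⟩
      y + k + 1          ≡⟨ regroup y k ⟩
      y + suc k * 1      ∎
    step {x} {y} (no y≰x) _ = begin
      x + 1              ≡⟨ +-comm x 1 ⟩
      suc x              ≤⟨ ≰⇒> y≰x ⟩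
      y                  ≡⟨ sym (trans (cong (y +_) (*-zeroʳ (suc k))) (+-identityʳ y)) ⟩
      y + suc k * 0      ∎
    rise : ∀ u w → Arc G u w → depth u + 1 ≤ depth w + correction u w
    rise u w arc = step (depth w ≤? depth u) (descent-bound short arc)

  -- Second bound: m² ≤ 6 n³ k.  Rank the vertices by depth; backward arcs
  -- then do not climb in depth.
  short-chords⇒numArcs²≤ : ∀ {k} → Eulerian G → ShortChords k →
    numArcs G * numArcs G ≤ 6 * ((n * n) * (n * k))
  short-chords⇒numArcs²≤ {k} eulerian short =
    ≤-trans numArcs²≤backward
            (*-monoʳ-≤ 6 (*-monoʳ-≤ (n * n) (≤-trans backward≤descending (descendingArcs≤ short))))
    where
    open InjectiveRank (lexRank depth) (lexRank-injective depth)
    open RankedArcs G eulerian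
    backward≤descending : backwardArcs ≤ descendingArcs
    backward≤descending = arcSum-mono (λ u w _ → 𝟙-mono (w ≺? u) (depth w ≤? depth u) (lexRank-below depth))

-- Integer square roots

floorSqrt² : ∀ x → floorSqrt x * floorSqrt x ≤ x
floorSqrt² zero    = z≤n
floorSqrt² (suc x) = step (floorSqrt x) (suc (floorSqrt x) * suc (floorSqrt x) ≤? suc x) (floorSqrt² x)
  where
  step : ∀ r (d : Dec (suc r * suc r ≤ suc x)) → r * r ≤ x →
         (if does d then suc r else r) * (if does d then suc r else r) ≤ suc x
  step r (yes r+1²≤) _   = r+1²≤
  step r (no _)      r²≤ = m≤n⇒m≤1+n r²≤

floorSqrtDiv< : ∀ m k L → m < suc k * (L * L) → 1 + floorSqrtDiv m (suc k) ≤ L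
floorSqrtDiv< m k L m<kL² = ≮⇒≥ (λ L<1+root → <-irrefl refl (begin-strict
  L * L                               ≤⟨ *-mono-≤ (s≤s⁻¹ L<1+root) (s≤s⁻¹ L<1+root) ⟩
  floorSqrt q * floorSqrt q           ≤⟨ floorSqrt² q ⟩
  q                                   <⟨ m<n*o⇒m/o<n (subst (m <_) (*-comm (suc k) (L * L)) m<kL²) ⟩
  L * L                               ∎))
  where
  open ≤-Reasoning
  q : ℕ
  q = m / suc k

module MainArgument {n′ : ℕ} (G : Digraph (suc n′)) (eulerian : Eulerian G) (m≥1 : 1 ≤ numArcs G) where
  open LongestPaths G

  private
    n m : ℕ
    n = suc n′
    m = numArcs G

  -- K is long enough for both conclusions of the theorem.
  Long : ℕ → Set
  Long K = m < n * (K * K) × m ^ 2 ≤ 24 * n ^ 3 * (K ∸ 1)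

  Long-mono : ∀ {K L} → K ≤ L → Long K → Long L
  Long-mono K≤L (m<nK² , m²≤) =
    <-≤-trans m<nK² (*-monoʳ-≤ n (*-mono-≤ K≤L K≤L))
    , ≤-trans m²≤ (*-monoʳ-≤ (24 * n ^ 3) (∸-monoˡ-≤ 1 K≤L))

  m² : m ^ 2 ≡ m * m
  m² = cong (m *_) (*-identityʳ m)

  short-chords⇒Long : ∀ {k} → ShortChords k → Long (suc k)
  short-chords⇒Long {k} short = few , few²
    where
    few : m < n * (suc k * suc k)
    few = begin-strict
      m                                ≤⟨ short-chords⇒numArcs≤ eulerian short ⟩
      suc k * (n * k)                  <⟨ m<m+n (suc k * (n * k)) (s≤s z≤n) ⟩
      suc k * (n * k) + n * suc k      ≡⟨ expand n k ⟩
      n * (suc k * suc k)              ∎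
      where
      open ≤-Reasoning
      expand : ∀ n k → suc k * (n * k) + n * suc k ≡ n * (suc k * suc k)
      expand = solve-∀
    few² : m ^ 2 ≤ 24 * n ^ 3 * k
    few² = begin
      m ^ 2                                    ≡⟨ m² ⟩
      m * m                                    ≤⟨ short-chords⇒numArcs²≤ eulerian short ⟩
      6 * ((n * n) * (n * k))                  ≤⟨ m≤m+n _ (18 * ((n * n) * (n * k))) ⟩
      6 * ((n * n) * (n * k)) + 18 * ((n * n) * (n * k)) ≡⟨ collect n k ⟩
      24 * n ^ 3 * k                           ∎
      where
      open ≤-Reasoning
      collect : ∀ n k → 6 * ((n * n) * (n * k)) + 18 * ((n * n) * (n * k)) ≡ 24 * (n * (n * (n * 1))) * k
      collect = solve-∀

  -- Descend from a long K: at each step either a long enough cycle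
  -- appears, or all chords are short and K - 1 is long as well.
  search : ∀ K → Long K → ∃[ L ] (HasCycleOfLength G L × Long L)
  search zero          (m<0 , _)  = contradiction (subst (m <_) (*-zeroʳ n) m<0) (λ ())
  search (suc zero)    (_ , m²≤0) = contradiction (subst (m ^ 2 ≤_) (*-zeroʳ (24 * n ^ 3)) m²≤0) (<⇒≱ 0<m²)
    where
    0<m² : 0 < m ^ 2
    0<m² = subst (0 <_) (sym m²) (*-mono-≤ m≥1 m≥1)
  search (suc (suc k)) long =
    [ (λ { (L , cycle , k+2≤L) → L , cycle , Long-mono k+2≤L long })
    , (λ short → search (suc k) (short-chords⇒Long short))
    ]′ (long-cycle-or-short-chords k)

  initial : Long (suc (m * m))
  initial = <-≤-trans (s≤s (m≤m*m m)) (≤-trans (m≤m*n K K) (m≤n*m (K * K) n))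
          , ≤-trans (≤-reflexive (trans m² (sym (*-identityˡ (m * m)))))
                    (*-monoˡ-≤ (m * m) {1} {24 * n ^ 3} (s≤s z≤n))
    where
    K : ℕ
    K = suc (m * m)
    m≤m*m : ∀ x → x ≤ x * x
    m≤m*m zero      = z≤n
    m≤m*m x@(suc _) = m≤m*n x x

  conclusion :
    (∃[ L ] (HasCycleOfLength G L × 1 + floorSqrtDiv m n ≤ L))
    × (∃[ L ] (HasCycleOfLength G L × 1 + floorSqrtDiv m n ≤ L × m ^ 2 ≤ 24 * n ^ 3 * (L ∸ 1)))
  conclusion = both (search (suc (m * m)) initial)
    where
    both : ∃[ L ] (HasCycleOfLength G L × Long L) →
      (∃[ L ] (HasCycleOfLength G L × 1 + floorSqrtDiv m n ≤ L))
      × (∃[ L ] (HasCycleOfLength G L × 1 + floorSqrtDiv m n ≤ L × m ^ 2 ≤ 24 * n ^ 3 * (L ∸ 1)))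
    both (L , cycle , m<nL² , m²≤) = (L , cycle , root<L) , (L , cycle , root<L , m²≤)
      where
      root<L : 1 + floorSqrtDiv m n ≤ L
      root<L = floorSqrtDiv< m n′ L m<nL²

proposition1p5 : (n : ℕ) (G : Digraph n) → Eulerian G → 1 ≤ numArcs G →
    (∃[ L ] (HasCycleOfLength G L × 1 + floorSqrtDiv (numArcs G) n ≤ L))
    × (∃[ L ] (HasCycleOfLength G L
         × 1 + floorSqrtDiv (numArcs G) n ≤ L
         × numArcs G ^ 2 ≤ 24 * n ^ 3 * (L ∸ 1)))
proposition1p5 zero     G eulerian ()
proposition1p5 (suc n′) G eulerian m≥1 = MainArgument.conclusion G eulerian m≥1
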